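{- Let $(\mathcal{E},\mathcal{S})$ be a category with display maps and $\mathbf{y}:(\mathcal{E},\mathcal{S})\to(\overline{\mathcal{E}},\overline{\mathcal{S}})$ its exact completion. Then $\mathcal{S}$ is representable if and only if $\overline{\mathcal{S}}$ is. Moreover, $\mathbf{y}$ preserves and reflects representations: for $\pi\in\mathcal{S}$, $\pi$ is a representation for $\mathcal{S}$ iff $\mathbf{y}\pi$ is a representation for $\overline{\mathcal{S}}$.
   Context: Cover: $f=mg$, $m$ mono $\Rightarrow m$ iso. Positive Heyting category: finite limits, stable (cover, mono)-factorisations, disjoint stable finite coproducts, right adjoints $\forall_f$ to pullback of subobjects. Covering square: commutative square with bottom a cover, top-left corner covering the pullback of bottom and right sides; its left side then covers its right side. Axioms on a class $\mathcal{S}$: (A1) pullback stable; (A2) descent along covers; (A3) sums of maps; (A4) $0\to1,1\to1,1+1\to1\in\mathcal{S}$; (A5) composition; (A6) if $g\circ e\in\mathcal{S}$, $e$ a cover, then $g\in\mathcal{S}$; (A7) Collection: for a cover $p:Y\to X$ and $f:X\to A\in\mathcal{S}$ there is a covering square with left side in $\mathcal{S}$, top factoring through $p$, right side $f$; (A8) $\forall_f$, $f\in\mathcal{S}$, preserves subobjects represented by monos in $\mathcal{S}$; (A9) diagonals in $\mathcal{S}$; (A10) if $m\circ e\in\mathcal{S}$ with $e$ cover and $m$ mono then $m\in\mathcal{S}$. Class of small maps: (A1)–(A9); class of display maps: (A1),(A3)–(A5),(A7)–(A10). Category with small (display) maps: a positive Heyting category with such a class. $\mathcal{S}^{\mathrm{cov}}$: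 maps covered by a map in $\mathcal{S}$; it is a class of small maps. Bounded exactness, morphisms and exact completion: a morphism of categories with small maps preserves the positive Heyting structure and small maps; an exact category with small maps is one where every equivalence relation given by a small mono has a pullback-stable effective quotient; the exact completion of a category with small maps $(\mathcal{E},\mathcal{T})$ is an exact category with small maps with a morphism $\mathbf{y}$ from $(\mathcal{E},\mathcal{T})$ through which morphisms into exact categories with small maps factor uniquely up to equivalence; it exists, $\mathbf{y}$ is full, faithful, covering and bijective on subobjects. The exact completion of a category with display maps $(\mathcal{E},\mathcal{S})$ is the exact completion $(\overline{\mathcal{E}},\overline{\mathcal{S}})$ of $(\mathcal{E},\mathcal{S}^{\mathrm{cov}})$; a map lies in $\overline{\mathcal{S}}$ iff it is covered by $\mathbf{y}f'$ with $f'\in\mathcal{S}$. A representation for a class $\mathcal{T}$ is a map $\pi\in\mathcal{T}$ such that every map of $\mathcal{T}$ is covered by some pullback of $\pi$; $\mathcal{T}$ is representable if it has one. -}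

module Defs where

open import Level using (Level; _⊔_) renaming (suc to lsuc)
open import Data.Product using (Σ; _×_; _,_; proj₁; proj₂; Σ-syntax)
open import Relation.Binary using (IsEquivalence)
open import Function.Bundles using (_⇔_)

record Category (o ℓ e : Level) : Set (lsuc (o ⊔ ℓ ⊔ e)) where
  infix  4 _≈_
  infixr 9 _∘_
  field
    Obj : Set o
    _⇒_ : Obj → Obj → Set ℓ
    _≈_ : ∀ {A B} → A ⇒ B → A ⇒ B → Set e
    id  : ∀ {A} → A ⇒ A
    _∘_ : ∀ {A B C} → B ⇒ C → A ⇒ B → A ⇒ C
    equiv     : ∀ {A B} → IsEquivalence (_≈_ {A} {B})
    ∘-resp-≈  : ∀ {A B C} {f h : B ⇒ C} {g i : A ⇒ B} → f ≈ h → g ≈ i → f ∘ g ≈ h ∘ i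
    assoc     : ∀ {A B C D} {f : A ⇒ B} {g : B ⇒ C} {h : C ⇒ D} → (h ∘ g) ∘ f ≈ h ∘ (g ∘ f)
    identityˡ : ∀ {A B} {f : A ⇒ B} → id ∘ f ≈ f
    identityʳ : ∀ {A B} {f : A ⇒ B} → f ∘ id ≈ f

  ≈-refl : ∀ {A B} {f : A ⇒ B} → f ≈ f
  ≈-refl = IsEquivalence.refl equiv

Class : ∀ {o ℓ e} → Category o ℓ e → (s : Level) → Set (o ⊔ ℓ ⊔ lsuc s)
Class 𝒞 s = ∀ {A B} → A ⇒ B → Set s
  where open Category 𝒞

module Notions {o ℓ e} (𝒞 : Category o ℓ e) where
  open Category 𝒞

  Mono : ∀ {A B} → A ⇒ B → Set (o ⊔ ℓ ⊔ e)
  Mono {A} m = ∀ {X} (g h : X ⇒ A) → m ∘ g ≈ m ∘ h → g ≈ h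

  IsIso : ∀ {A B} → A ⇒ B → Set (ℓ ⊔ e)
  IsIso {A} {B} f = Σ[ g ∈ B ⇒ A ] (g ∘ f ≈ id × f ∘ g ≈ id)

  Cover : ∀ {A B} → A ⇒ B → Set (o ⊔ ℓ ⊔ e)
  Cover {A} {B} f = ∀ {M} (g : A ⇒ M) (m : M ⇒ B) → f ≈ m ∘ g → Mono m → IsIso m

  IsTerminal : Obj → Set (o ⊔ ℓ ⊔ e)
  IsTerminal T = ∀ X → Σ[ t ∈ X ⇒ T ] (∀ (u : X ⇒ T) → u ≈ t)

  IsInitial : Obj → Set (o ⊔ ℓ ⊔ e)
  IsInitial I = ∀ X → Σ[ t ∈ I ⇒ X ] (∀ (u : I ⇒ X) → u ≈ t)

  _≤_ : ∀ {M N B} → M ⇒ B → N ⇒ B → Set (ℓ ⊔ e)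
  _≤_ {M} {N} m n = Σ[ k ∈ M ⇒ N ] (n ∘ k ≈ m)

  record IsPullback {P A B C} (p₁ : P ⇒ A) (p₂ : P ⇒ B) (f : A ⇒ C) (g : B ⇒ C)
         : Set (o ⊔ ℓ ⊔ e) where
    field
      commute      : f ∘ p₁ ≈ g ∘ p₂
      universal    : ∀ {X} {h₁ : X ⇒ A} {h₂ : X ⇒ B} → f ∘ h₁ ≈ g ∘ h₂ → X ⇒ P
      universal-p₁ : ∀ {X} {h₁ : X ⇒ A} {h₂ : X ⇒ B} (eq : f ∘ h₁ ≈ g ∘ h₂) → p₁ ∘ universal eq ≈ h₁
      universal-p₂ : ∀ {X} {h₁ : X ⇒ A} {h₂ : X ⇒ B} (eq : f ∘ h₁ ≈ g ∘ h₂) → p₂ ∘ universal eq ≈ h₂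
      unique       : ∀ {X} {h₁ : X ⇒ A} {h₂ : X ⇒ B} (eq : f ∘ h₁ ≈ g ∘ h₂) (u : X ⇒ P) →
                     p₁ ∘ u ≈ h₁ → p₂ ∘ u ≈ h₂ → u ≈ universal eq

  record Pullback {A B C} (f : A ⇒ C) (g : B ⇒ C) : Set (o ⊔ ℓ ⊔ e) where
    field
      P          : Obj
      p₁         : P ⇒ A
      p₂         : P ⇒ B
      isPullback : IsPullback p₁ p₂ f g

  record IsCoproduct {A B S} (i₁ : A ⇒ S) (i₂ : B ⇒ S) : Set (o ⊔ ℓ ⊔ e) where
    field
      [_,_]   : ∀ {X} → A ⇒ X → B ⇒ X → S ⇒ X
      inject₁ : ∀ {X} {f : A ⇒ X} {g : B ⇒ X} → [ f , g ] ∘ i₁ ≈ f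
      inject₂ : ∀ {X} {f : A ⇒ X} {g : B ⇒ X} → [ f , g ] ∘ i₂ ≈ g
      unique  : ∀ {X} {f : A ⇒ X} {g : B ⇒ X} (h : S ⇒ X) →
                h ∘ i₁ ≈ f → h ∘ i₂ ≈ g → h ≈ [ f , g ]

  record IsCoequalizer {R X Q} (r₁ r₂ : R ⇒ X) (q : X ⇒ Q) : Set (o ⊔ ℓ ⊔ e) where
    field
      equality   : q ∘ r₁ ≈ q ∘ r₂
      coequalize : ∀ {Y} {h : X ⇒ Y} → h ∘ r₁ ≈ h ∘ r₂ → Q ⇒ Y
      universal  : ∀ {Y} {h : X ⇒ Y} (eq : h ∘ r₁ ≈ h ∘ r₂) → coequalize eq ∘ q ≈ h
      unique     : ∀ {Y} {h : X ⇒ Y} (eq : h ∘ r₁ ≈ h ∘ r₂) (u : Q ⇒ Y) →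
                   u ∘ q ≈ h → u ≈ coequalize eq

record PositiveHeyting {o ℓ e} (𝒞 : Category o ℓ e) : Set (o ⊔ ℓ ⊔ e) where
  open Category 𝒞
  open Notions 𝒞
  infixr 30 _+_
  field
    ⊤          : Obj
    ⊤-terminal : IsTerminal ⊤
    pb         : ∀ {A B C} (f : A ⇒ C) (g : B ⇒ C) → Pullback f g
    image        : ∀ {A B} (f : A ⇒ B) →
                   Σ[ I ∈ Obj ] Σ[ c ∈ A ⇒ I ] Σ[ m ∈ I ⇒ B ] (Cover c × Mono m × f ≈ m ∘ c)
    cover-stable : ∀ {P A B C} {p₁ : P ⇒ A} {p₂ : P ⇒ B} {f : A ⇒ C} {g : B ⇒ C} →
                   IsPullback p₁ p₂ f g → Cover f → Cover p₂
    ⊥           : Obj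
    ⊥-initial   : IsInitial ⊥
    ⊥-stable    : ∀ {X} → X ⇒ ⊥ → IsInitial X
    _+_         : Obj → Obj → Obj
    i₁          : ∀ {A B} → A ⇒ A + B
    i₂          : ∀ {A B} → B ⇒ A + B
    +-coproduct : ∀ {A B} → IsCoproduct (i₁ {A} {B}) (i₂ {A} {B})
    i₁-mono     : ∀ {A B} → Mono (i₁ {A} {B})
    i₂-mono     : ∀ {A B} → Mono (i₂ {A} {B})
    disjoint    : ∀ {A B P} {p₁ : P ⇒ A} {p₂ : P ⇒ B} →
                  IsPullback p₁ p₂ (i₁ {A} {B}) (i₂ {A} {B}) → IsInitial P
    +-stable    : ∀ {A B X P Q} (h : X ⇒ A + B)
                  {p : P ⇒ A} {j : P ⇒ X} {q : Q ⇒ B} {k : Q ⇒ X} →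
                  IsPullback p j i₁ h → IsPullback q k i₂ h → IsCoproduct j k
    ∀Obj  : ∀ {A B M} (f : A ⇒ B) (m : M ⇒ A) → Mono m → Obj
    ∀map  : ∀ {A B M} (f : A ⇒ B) (m : M ⇒ A) (mm : Mono m) → ∀Obj f m mm ⇒ B
    ∀mono : ∀ {A B M} (f : A ⇒ B) (m : M ⇒ A) (mm : Mono m) → Mono (∀map f m mm)
    ∀adj  : ∀ {A B M} (f : A ⇒ B) (m : M ⇒ A) (mm : Mono m) {K} (k : K ⇒ B) → Mono k →
            (Pullback.p₂ (pb k f) ≤ m) ⇔ (k ≤ ∀map f m mm)

module HeytingNotions {o ℓ e} {𝒞 : Category o ℓ e} (H : PositiveHeyting 𝒞) where
  open Category 𝒞
  open Notions 𝒞
  open PositiveHeyting H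

  ! : ∀ {X} → X ⇒ ⊤
  ! {X} = proj₁ (⊤-terminal X)

  ¡ : ∀ {X} → ⊥ ⇒ X
  ¡ {X} = proj₁ (⊥-initial X)

  _⊕_ : ∀ {A B C D} → A ⇒ B → C ⇒ D → A + C ⇒ B + D
  f ⊕ g = IsCoproduct.[_,_] +-coproduct (i₁ ∘ f) (i₂ ∘ g)

  infixr 25 _×ₒ_
  infixr 20 _⊕_
  _×ₒ_ : Obj → Obj → Obj
  X ×ₒ Y = Pullback.P (pb (! {X}) (! {Y}))

  π₁ : ∀ {X Y} → X ×ₒ Y ⇒ X
  π₁ {X} {Y} = Pullback.p₁ (pb (! {X}) (! {Y}))

  π₂ : ∀ {X Y} → X ×ₒ Y ⇒ Y
  π₂ {X} {Y} = Pullback.p₂ (pb (! {X}) (! {Y}))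

  diagonal : ∀ {A B} (f : A ⇒ B) → A ⇒ Pullback.P (pb f f)
  diagonal {A} f = IsPullback.universal (Pullback.isPullback (pb f f)) {A} {id} {id} ≈-refl

  -- Covering square
  --        top
  --     D -----> X
  -- left|        | right
  --     v        v
  --     B -----> A
  --       bottom
  -- commuting, with bottom a cover and the induced map from D to the
  -- pullback of bottom and right a cover.
  record CoveringSquare {D X B A} (left : D ⇒ B) (top : D ⇒ X)
                        (right : X ⇒ A) (bottom : B ⇒ A) : Set (o ⊔ ℓ ⊔ e) where
    field
      commutes     : bottom ∘ left ≈ right ∘ top
      bottom-cover : Cover bottom
      corner-cover : Cover (IsPullback.universal (Pullback.isPullback (pb bottom right)) commutes)

  CoveredBy : ∀ {X A D B} (f : X ⇒ A) (g : D ⇒ B) → Set (o ⊔ ℓ ⊔ e)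
  CoveredBy {X} {A} {D} {B} f g =
    Σ[ top ∈ D ⇒ X ] Σ[ bottom ∈ B ⇒ A ] CoveringSquare g top f bottom

  module _ {s} (S : Class 𝒞 s) where

    A1 = ∀ {P A B C} {p₁ : P ⇒ A} {p₂ : P ⇒ B} {f : A ⇒ C} {g : B ⇒ C} →
         IsPullback p₁ p₂ f g → S f → S p₂
    A2 = ∀ {P A B C} {p₁ : P ⇒ A} {p₂ : P ⇒ B} {f : A ⇒ C} {g : B ⇒ C} →
         IsPullback p₁ p₂ f g → Cover g → S p₂ → S f
    A3 = ∀ {A B C D} {f : A ⇒ B} {g : C ⇒ D} → S f → S g → S (f ⊕ g)
    A4 = S (¡ {⊤}) × S (! {⊤}) × S (! {⊤ + ⊤})
    A5 = ∀ {A B C} {f : A ⇒ B} {g : B ⇒ C} → S f → S g → S (g ∘ f)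
    A6 = ∀ {A B C} {c : A ⇒ B} {g : B ⇒ C} → S (g ∘ c) → Cover c → S g
    A7 = ∀ {Y X A} (p : Y ⇒ X) → Cover p → (f : X ⇒ A) → S f →
         Σ[ D ∈ Obj ] Σ[ B ∈ Obj ] Σ[ g ∈ D ⇒ B ] Σ[ t ∈ D ⇒ X ] Σ[ q ∈ B ⇒ A ]
           (S g × CoveringSquare g t f q × Σ[ t' ∈ D ⇒ Y ] (p ∘ t' ≈ t))
    A8 = ∀ {A B M} (f : A ⇒ B) → S f → (m : M ⇒ A) (mm : Mono m) → S m → S (∀map f m mm)
    A9 = ∀ {A B} (f : A ⇒ B) → S f → S (diagonal f)
    A10 = ∀ {A B C} {c : A ⇒ B} {m : B ⇒ C} → S (m ∘ c) → Cover c → Mono m → S m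

    record IsClassOfSmallMaps : Set (o ⊔ ℓ ⊔ e ⊔ s) where
      field
        a1 : A1
        a2 : A2
        a3 : A3
        a4 : A4
        a5 : A5
        a6 : A6
        a7 : A7
        a8 : A8
        a9 : A9

    record IsClassOfDisplayMaps : Set (o ⊔ ℓ ⊔ e ⊔ s) where
      field
        a1 : A1
        a3 : A3
        a4 : A4
        a5 : A5
        a7 : A7
        a8 : A8
        a9 : A9
        a10 : A10

    Cov : Class 𝒞 (o ⊔ ℓ ⊔ e ⊔ s)
    Cov f = Σ[ D ∈ Obj ] Σ[ B ∈ Obj ] Σ[ g ∈ D ⇒ B ] (S g × CoveredBy f g)

    record IsEquivalenceRelation {R X} (r : R ⇒ X ×ₒ X) : Set (o ⊔ ℓ ⊔ e) where
      field
        mono       : Mono r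
        reflexive  : Σ[ ρ ∈ X ⇒ R ] ((π₁ ∘ r) ∘ ρ ≈ id × (π₂ ∘ r) ∘ ρ ≈ id)
        symmetric  : Σ[ σ ∈ R ⇒ R ] ((π₁ ∘ r) ∘ σ ≈ π₂ ∘ r × (π₂ ∘ r) ∘ σ ≈ π₁ ∘ r)
        transitive : Σ[ τ ∈ Pullback.P (pb (π₂ ∘ r) (π₁ ∘ r)) ⇒ R ]
                       ((π₁ ∘ r) ∘ τ ≈ (π₁ ∘ r) ∘ Pullback.p₁ (pb (π₂ ∘ r) (π₁ ∘ r)) ×
                        (π₂ ∘ r) ∘ τ ≈ (π₂ ∘ r) ∘ Pullback.p₂ (pb (π₂ ∘ r) (π₁ ∘ r)))

    IsQuotientOfKernelPair : ∀ {X Q} → X ⇒ Q → Set (o ⊔ ℓ ⊔ e)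
    IsQuotientOfKernelPair q = IsCoequalizer (Pullback.p₁ (pb q q)) (Pullback.p₂ (pb q q)) q

    IsExact : Set (o ⊔ ℓ ⊔ e ⊔ s)
    IsExact = ∀ {R X} (r : R ⇒ X ×ₒ X) (eqr : IsEquivalenceRelation r) → S r →
      Σ[ Q ∈ Obj ] Σ[ q ∈ X ⇒ Q ]
        ( IsCoequalizer (π₁ ∘ r) (π₂ ∘ r) q
        × IsPullback (π₁ ∘ r) (π₂ ∘ r) q q
        × (∀ {Q'} (h : Q' ⇒ Q) →
             IsQuotientOfKernelPair (Pullback.p₂ (pb q h))))

    IsRepresentation : ∀ {E U} → E ⇒ U → Set (o ⊔ ℓ ⊔ e ⊔ s)
    IsRepresentation {E} {U} π =
      S π × (∀ {X A} (f : X ⇒ A) → S f →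
               Σ[ V ∈ Obj ] Σ[ P ∈ Obj ] Σ[ h ∈ V ⇒ U ] Σ[ p₁ ∈ P ⇒ E ] Σ[ p₂ ∈ P ⇒ V ]
                 (IsPullback p₁ p₂ π h × CoveredBy f p₂))

    Representable : Set (o ⊔ ℓ ⊔ e ⊔ s)
    Representable = Σ[ E ∈ Obj ] Σ[ U ∈ Obj ] Σ[ π ∈ E ⇒ U ] IsRepresentation π

record Functor {o ℓ e o' ℓ' e'} (𝒞 : Category o ℓ e) (𝒟 : Category o' ℓ' e')
       : Set (o ⊔ ℓ ⊔ e ⊔ o' ⊔ ℓ' ⊔ e') where
  private
    module C = Category 𝒞
    module D = Category 𝒟
  field
    F₀ : C.Obj → D.Obj
    F₁ : ∀ {A B} → A C.⇒ B → F₀ A D.⇒ F₀ B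
    F-resp-≈     : ∀ {A B} {f g : A C.⇒ B} → f C.≈ g → F₁ f D.≈ F₁ g
    identity     : ∀ {A} → F₁ (C.id {A}) D.≈ D.id
    homomorphism : ∀ {A B C} {f : A C.⇒ B} {g : B C.⇒ C} → F₁ (g C.∘ f) D.≈ F₁ g D.∘ F₁ f

_∘F_ : ∀ {o₁ ℓ₁ e₁ o₂ ℓ₂ e₂ o₃ ℓ₃ e₃}
       {𝒞 : Category o₁ ℓ₁ e₁} {𝒟 : Category o₂ ℓ₂ e₂} {ℰ : Category o₃ ℓ₃ e₃} →
       Functor 𝒟 ℰ → Functor 𝒞 𝒟 → Functor 𝒞 ℰ
_∘F_ {ℰ = ℰ} G F = record
  { F₀ = λ A → G.F₀ (F.F₀ A)
  ; F₁ = λ f → G.F₁ (F.F₁ f)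
  ; F-resp-≈ = λ eq → G.F-resp-≈ (F.F-resp-≈ eq)
  ; identity = IsEquivalence.trans E.equiv (G.F-resp-≈ F.identity) G.identity
  ; homomorphism = IsEquivalence.trans E.equiv (G.F-resp-≈ F.homomorphism) G.homomorphism
  }
  where
    module F = Functor F
    module G = Functor G
    module E = Category ℰ

record NatIso {o ℓ e o' ℓ' e'} {𝒞 : Category o ℓ e} {𝒟 : Category o' ℓ' e'}
              (F G : Functor 𝒞 𝒟) : Set (o ⊔ ℓ ⊔ e ⊔ o' ⊔ ℓ' ⊔ e') where
  private
    module C = Category 𝒞
    module D = Category 𝒟
    module F = Functor F
    module G = Functor G
  field
    η       : ∀ A → F.F₀ A D.⇒ G.F₀ A
    η-iso   : ∀ A → Notions.IsIso 𝒟 (η A)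
    natural : ∀ {A B} (f : A C.⇒ B) → η B D.∘ F.F₁ f D.≈ G.F₁ f D.∘ η A

record Morphism {o ℓ e s o' ℓ' e' s'}
                {𝒞 : Category o ℓ e} (H𝒞 : PositiveHeyting 𝒞) (S : Class 𝒞 s)
                {𝒟 : Category o' ℓ' e'} (H𝒟 : PositiveHeyting 𝒟) (T : Class 𝒟 s')
       : Set (o ⊔ ℓ ⊔ e ⊔ s ⊔ o' ⊔ ℓ' ⊔ e' ⊔ s') where
  private
    module C = Category 𝒞
    module D = Category 𝒟
    module NC = Notions 𝒞
    module ND = Notions 𝒟
    module HC = PositiveHeyting H𝒞
    module HD = PositiveHeyting H𝒟
  field
    functor : Functor 𝒞 𝒟
  open Functor functor public
  field
    pres-terminal  : ND.IsTerminal (F₀ HC.⊤)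
    pres-pullback  : ∀ {P A B C} {p₁ : P C.⇒ A} {p₂ : P C.⇒ B} {f : A C.⇒ C} {g : B C.⇒ C} →
                     NC.IsPullback p₁ p₂ f g → ND.IsPullback (F₁ p₁) (F₁ p₂) (F₁ f) (F₁ g)
    pres-cover     : ∀ {A B} {f : A C.⇒ B} → NC.Cover f → ND.Cover (F₁ f)
    pres-initial   : ND.IsInitial (F₀ HC.⊥)
    pres-coproduct : ∀ {A B S} {i₁ : A C.⇒ S} {i₂ : B C.⇒ S} →
                     NC.IsCoproduct i₁ i₂ → ND.IsCoproduct (F₁ i₁) (F₁ i₂)
    pres-∀         : ∀ {A B M} (f : A C.⇒ B) (m : M C.⇒ A) (mm : NC.Mono m)
                     (Fmm : ND.Mono (F₁ m)) →
                     ND._≤_ (F₁ (HC.∀map f m mm)) (HD.∀map (F₁ f) (F₁ m) Fmm) ×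
                     ND._≤_ (HD.∀map (F₁ f) (F₁ m) Fmm) (F₁ (HC.∀map f m mm))
    pres-small     : ∀ {A B} {f : A C.⇒ B} → S f → T (F₁ f)

-- Exact completion of a category with display maps (𝓔, S):
-- the exact completion of the category with small maps (𝓔, S^cov).
-- The universal property is stated for target categories at the same
-- universe levels as the completion.

module _ {o ℓ e s o' ℓ' e' s'}
         {𝓔 : Category o ℓ e} (H𝓔 : PositiveHeyting 𝓔) (S : Class 𝓔 s)
         {𝓔̄ : Category o' ℓ' e'} (H𝓔̄ : PositiveHeyting 𝓔̄) (S̄ : Class 𝓔̄ s') where

  private
    module E  = Category 𝓔
    module Ē  = Category 𝓔̄
    module NE = Notions 𝓔
    module NĒ = Notions 𝓔̄
    module HE = HeytingNotions H𝓔
    module HĒ = HeytingNotions H𝓔̄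

  record IsExactCompletion (y : Morphism H𝓔 (HE.Cov S) H𝓔̄ S̄)
         : Set (lsuc (o' ⊔ ℓ' ⊔ e' ⊔ s') ⊔ o ⊔ ℓ ⊔ e ⊔ s) where
    field
      small : HĒ.IsClassOfSmallMaps S̄
      exact : HĒ.IsExact S̄
      factor : ∀ (𝒟 : Category o' ℓ' e') (H𝒟 : PositiveHeyting 𝒟) (T : Class 𝒟 s') →
               HeytingNotions.IsClassOfSmallMaps H𝒟 T → HeytingNotions.IsExact H𝒟 T →
               (G : Morphism H𝓔 (HE.Cov S) H𝒟 T) →
               Σ[ K ∈ Morphism H𝓔̄ S̄ H𝒟 T ]
                 NatIso (Morphism.functor K ∘F Morphism.functor y) (Morphism.functor G)
      factor-unique : ∀ (𝒟 : Category o' ℓ' e') (H𝒟 : PositiveHeyting 𝒟) (T : Class 𝒟 s') →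
               HeytingNotions.IsClassOfSmallMaps H𝒟 T → HeytingNotions.IsExact H𝒟 T →
               (G : Morphism H𝓔 (HE.Cov S) H𝒟 T) →
               (K K' : Morphism H𝓔̄ S̄ H𝒟 T) →
               NatIso (Morphism.functor K ∘F Morphism.functor y) (Morphism.functor G) →
               NatIso (Morphism.functor K' ∘F Morphism.functor y) (Morphism.functor G) →
               NatIso (Morphism.functor K) (Morphism.functor K')

  -- The properties of the exact completion established in the paper
  -- (recalled in the context): y is full, faithful, covering and bijective
  -- on subobjects, and S̄ consists of the maps covered by some y f' with f' ∈ S.
  record CompletionProperties (y : Morphism H𝓔 (HE.Cov S) H𝓔̄ S̄)
         : Set (o ⊔ ℓ ⊔ e ⊔ s ⊔ o' ⊔ ℓ' ⊔ e' ⊔ s') where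
    open Morphism y
    field
      full     : ∀ {A B} (g : F₀ A Ē.⇒ F₀ B) → Σ[ f ∈ A E.⇒ B ] (F₁ f Ē.≈ g)
      faithful : ∀ {A B} {f g : A E.⇒ B} → F₁ f Ē.≈ F₁ g → f E.≈ g
      covering : ∀ (X : Ē.Obj) → Σ[ A ∈ E.Obj ] Σ[ c ∈ F₀ A Ē.⇒ X ] NĒ.Cover c
      subobjects-surjective :
        ∀ {A N} (n : N Ē.⇒ F₀ A) → NĒ.Mono n →
        Σ[ M ∈ E.Obj ] Σ[ m ∈ M E.⇒ A ] (NE.Mono m × NĒ._≤_ (F₁ m) n × NĒ._≤_ n (F₁ m))
      subobjects-injective :
        ∀ {A M M'} (m : M E.⇒ A) (m' : M' E.⇒ A) → NE.Mono m → NE.Mono m' →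
        NĒ._≤_ (F₁ m) (F₁ m') → NĒ._≤_ (F₁ m') (F₁ m) → NE._≤_ m m' × NE._≤_ m' m
      small-maps : ∀ {X A} (f : X Ē.⇒ A) →
        S̄ f ⇔ (Σ[ D ∈ E.Obj ] Σ[ B ∈ E.Obj ] Σ[ f' ∈ D E.⇒ B ] (S f' × HĒ.CoveredBy f (F₁ f')))

-- A representation is preserved by any morphism that preserves pullbacks and
-- covering squares, so y π represents S̄ whenever π represents S: a map of S̄ is
-- covered by some y f' with f' ∈ S, and f' is covered by a pullback of π.
-- Conversely, if y π represents S̄ and f ∈ S, then y f is covered by a pullback
-- of y π along some h; precomposing h with a cover y A' ↠ V̄ and using fullness
-- turns this pullback into y of a pullback of π, and the resulting covering
-- square is reflected because y is full, faithful and reflects covers.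
-- Finally a representation ρ of S̄ is covered by some y f' with f' ∈ S, and
-- covering squares are stable under pullback, so y f' is a representation too.
module Submission where

open import Defs
open import Level using (Level)
open import Data.Product using (_×_; _,_; proj₁; proj₂; Σ-syntax)
open import Function.Bundles using (_⇔_; mk⇔; Equivalence)
open import Relation.Binary using (IsEquivalence; Setoid)
import Relation.Binary.Reasoning.Setoid as SetoidReasoning

module CategoryProperties {o ℓ e} (𝒞 : Category o ℓ e) where
  open Category 𝒞
  open Notions 𝒞

  open module ≈ {A} {B} = IsEquivalence (equiv {A} {B}) public using (sym; trans)

  hom-setoid : Obj → Obj → Setoid ℓ e
  hom-setoid A B = record { Carrier = A ⇒ B ; _≈_ = _≈_ ; isEquivalence = equiv }

  module HomReasoning {A B : Obj} = SetoidReasoning (hom-setoid A B)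
  open HomReasoning public

  infixr 4 _⟩∘⟨_ refl⟩∘⟨_
  infixl 5 _⟩∘⟨refl

  _⟩∘⟨_ : ∀ {A B C} {f h : B ⇒ C} {g i : A ⇒ B} → f ≈ h → g ≈ i → f ∘ g ≈ h ∘ i
  _⟩∘⟨_ = ∘-resp-≈

  refl⟩∘⟨_ : ∀ {A B C} {f : B ⇒ C} {g i : A ⇒ B} → g ≈ i → f ∘ g ≈ f ∘ i
  refl⟩∘⟨ p = ∘-resp-≈ ≈-refl p

  _⟩∘⟨refl : ∀ {A B C} {f h : B ⇒ C} {g : A ⇒ B} → f ≈ h → f ∘ g ≈ h ∘ g
  p ⟩∘⟨refl = ∘-resp-≈ p ≈-refl

  pullˡ : ∀ {X A B C} {a : B ⇒ C} {b : A ⇒ B} {c : A ⇒ C} {x : X ⇒ A} →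
          a ∘ b ≈ c → a ∘ (b ∘ x) ≈ c ∘ x
  pullˡ p = trans (sym assoc) (p ⟩∘⟨refl)

  pullʳ : ∀ {A B C D} {a : B ⇒ C} {b : A ⇒ B} {c : A ⇒ C} {x : C ⇒ D} →
          a ∘ b ≈ c → (x ∘ a) ∘ b ≈ x ∘ c
  pullʳ p = trans assoc (refl⟩∘⟨ p)

  id-iso : ∀ {A} → IsIso (id {A})
  id-iso = id , identityˡ , identityˡ

  iso⇒cover : ∀ {A B} {f : A ⇒ B} → IsIso f → Cover f
  iso⇒cover {f = f} (f⁻¹ , _ , ff⁻¹≈id) g m f≈mg m-mono = g ∘ f⁻¹ , left-inverse , right-inverse
    where
      right-inverse : m ∘ (g ∘ f⁻¹) ≈ id
      right-inverse = trans (pullˡ (sym f≈mg)) ff⁻¹≈id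
      left-inverse : (g ∘ f⁻¹) ∘ m ≈ id
      left-inverse = m-mono _ _ (trans (pullˡ right-inverse) (trans identityˡ (sym identityʳ)))

  cover-resp-≈ : ∀ {A B} {f f' : A ⇒ B} → f ≈ f' → Cover f → Cover f'
  cover-resp-≈ f≈f' f-cover g m f'≈mg = f-cover g m (trans f≈f' f'≈mg)

  module _ {P A B C} {p₁ : P ⇒ A} {p₂ : P ⇒ B} {f : A ⇒ C} {g : B ⇒ C}
           (pullback : IsPullback p₁ p₂ f g) where
    open IsPullback pullback

    pullback-ext : ∀ {X} {u v : X ⇒ P} → p₁ ∘ u ≈ p₁ ∘ v → p₂ ∘ u ≈ p₂ ∘ v → u ≈ v
    pullback-ext {u = u} {v} eq₁ eq₂ =
      trans (unique u-commutes u ≈-refl ≈-refl) (sym (unique u-commutes v (sym eq₁) (sym eq₂)))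
      where
        u-commutes : f ∘ (p₁ ∘ u) ≈ g ∘ (p₂ ∘ u)
        u-commutes = trans (pullˡ commute) assoc

    pullback-swap : IsPullback p₂ p₁ g f
    pullback-swap = record
      { commute      = sym commute
      ; universal    = λ eq → universal (sym eq)
      ; universal-p₁ = λ eq → universal-p₂ (sym eq)
      ; universal-p₂ = λ eq → universal-p₁ (sym eq)
      ; unique       = λ eq u eq₁ eq₂ → unique (sym eq) u eq₂ eq₁
      }

    pullback-resp-≈ : ∀ {f' : A ⇒ C} {g' : B ⇒ C} → f ≈ f' → g ≈ g' → IsPullback p₁ p₂ f' g'
    pullback-resp-≈ f≈f' g≈g' = record
      { commute      = trans (sym f≈f' ⟩∘⟨refl) (trans commute (g≈g' ⟩∘⟨refl))
      ; universal    = λ eq → universal (unprime eq)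
      ; universal-p₁ = λ eq → universal-p₁ (unprime eq)
      ; universal-p₂ = λ eq → universal-p₂ (unprime eq)
      ; unique       = λ eq → unique (unprime eq)
      }
      where
        unprime : ∀ {X} {h₁ : X ⇒ A} {h₂ : X ⇒ B} → _ ∘ h₁ ≈ _ ∘ h₂ → f ∘ h₁ ≈ g ∘ h₂
        unprime eq = trans (f≈f' ⟩∘⟨refl) (trans eq (sym g≈g' ⟩∘⟨refl))

    pullback-of-mono : Mono f → Mono p₂
    pullback-of-mono f-mono u v p₂u≈p₂v = pullback-ext (f-mono _ _ f∘p₁u≈f∘p₁v) p₂u≈p₂v
      where
        f∘p₁u≈f∘p₁v : f ∘ (p₁ ∘ u) ≈ f ∘ (p₁ ∘ v)
        f∘p₁u≈f∘p₁v = begin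
          f ∘ (p₁ ∘ u) ≈⟨ pullˡ commute ⟩
          (g ∘ p₂) ∘ u ≈⟨ pullʳ p₂u≈p₂v ⟩
          g ∘ (p₂ ∘ v) ≈⟨ pullˡ (sym commute) ⟩
          (f ∘ p₁) ∘ v ≈⟨ assoc ⟩
          f ∘ (p₁ ∘ v) ∎

  pullback-comparison : ∀ {P P' A B C} {p₁ : P ⇒ A} {p₂ : P ⇒ B} {p₁' : P' ⇒ A} {p₂' : P' ⇒ B}
                          {f : A ⇒ C} {g : B ⇒ C} →
                        IsPullback p₁ p₂ f g → IsPullback p₁' p₂' f g →
                        Σ[ φ ∈ P ⇒ P' ] (IsIso φ × p₁' ∘ φ ≈ p₁ × p₂' ∘ φ ≈ p₂)
  pullback-comparison pullback pullback' = φ , (ψ , ψφ≈id , φψ≈id) , p₁'φ≈p₁ , p₂'φ≈p₂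
    where
      open IsPullback
      φ = universal pullback' (commute pullback)
      ψ = universal pullback (commute pullback')
      p₁'φ≈p₁ = universal-p₁ pullback' (commute pullback)
      p₂'φ≈p₂ = universal-p₂ pullback' (commute pullback)
      p₁ψ≈p₁' = universal-p₁ pullback (commute pullback')
      p₂ψ≈p₂' = universal-p₂ pullback (commute pullback')
      ψφ≈id = pullback-ext pullback (trans (pullˡ p₁ψ≈p₁') (trans p₁'φ≈p₁ (sym identityʳ)))
                                    (trans (pullˡ p₂ψ≈p₂') (trans p₂'φ≈p₂ (sym identityʳ)))
      φψ≈id = pullback-ext pullback' (trans (pullˡ p₁'φ≈p₁) (trans p₁ψ≈p₁' (sym identityʳ)))
                                     (trans (pullˡ p₂'φ≈p₂) (trans p₂ψ≈p₂' (sym identityʳ)))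

  pullback-along-id : ∀ {X A} (f : X ⇒ A) → IsPullback id f f id
  pullback-along-id f = record
    { commute      = trans identityʳ (sym identityˡ)
    ; universal    = λ {_} {h₁} _ → h₁
    ; universal-p₁ = λ _ → identityˡ
    ; universal-p₂ = λ eq → trans eq identityˡ
    ; unique       = λ _ _ eq₁ _ → trans (sym identityˡ) eq₁
    }

  mono⇒trivial-kernel-pair : ∀ {A B} {m : A ⇒ B} → Mono m → IsPullback id id m m
  mono⇒trivial-kernel-pair m-mono = record
    { commute      = ≈-refl
    ; universal    = λ {_} {h₁} _ → h₁
    ; universal-p₁ = λ _ → identityˡ
    ; universal-p₂ = λ eq → trans identityˡ (m-mono _ _ eq)
    ; unique       = λ _ _ eq₁ _ → trans (sym identityˡ) eq₁
    }

  equal-kernel-pair⇒mono : ∀ {P A B} {p : P ⇒ A} {m : A ⇒ B} → IsPullback p p m m → Mono m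
  equal-kernel-pair⇒mono pullback g h eq =
    trans (sym (IsPullback.universal-p₁ pullback eq)) (IsPullback.universal-p₂ pullback eq)

  -- Pasting lemma:   Q --q₂--> P --p₂--> B
  --                  |q₁       |p₁       |g
  --                  D --h---> A --f---> C
  pullback-glue : ∀ {P Q A B C D} {p₁ : P ⇒ A} {p₂ : P ⇒ B} {f : A ⇒ C} {g : B ⇒ C}
                    {q₁ : Q ⇒ D} {q₂ : Q ⇒ P} {h : D ⇒ A} →
                  IsPullback p₁ p₂ f g → IsPullback q₁ q₂ h p₁ →
                  IsPullback q₁ (p₂ ∘ q₂) (f ∘ h) g
  pullback-glue {B = B} {D = D} {p₁ = p₁} {p₂} {f} {g} {q₁} {q₂} {h} right left = record
    { commute      = begin
        (f ∘ h) ∘ q₁ ≈⟨ pullʳ (commute left) ⟩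
        f ∘ (p₁ ∘ q₂) ≈⟨ pullˡ (commute right) ⟩
        (g ∘ p₂) ∘ q₂ ≈⟨ assoc ⟩
        g ∘ (p₂ ∘ q₂) ∎
    ; universal    = λ eq → universal left (to-left eq)
    ; universal-p₁ = λ eq → universal-p₁ left (to-left eq)
    ; universal-p₂ = λ eq →
        trans (pullʳ (universal-p₂ left (to-left eq))) (universal-p₂ right (to-right eq))
    ; unique       = λ eq u q₁u≈x₁ p₂q₂u≈x₂ → unique left (to-left eq) u q₁u≈x₁
        (unique right (to-right eq) (q₂ ∘ u)
          (trans (pullˡ (sym (commute left))) (trans assoc (refl⟩∘⟨ q₁u≈x₁)))
          (trans (sym assoc) p₂q₂u≈x₂))
    }
    where
      open IsPullback
      to-right : ∀ {X} {x₁ : X ⇒ D} {x₂ : X ⇒ B} → (f ∘ h) ∘ x₁ ≈ g ∘ x₂ → f ∘ (h ∘ x₁) ≈ g ∘ x₂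
      to-right eq = trans (sym assoc) eq
      to-left : ∀ {X} {x₁ : X ⇒ D} {x₂ : X ⇒ B} (eq : (f ∘ h) ∘ x₁ ≈ g ∘ x₂) →
                h ∘ x₁ ≈ p₁ ∘ universal right (to-right eq)
      to-left eq = sym (universal-p₁ right (to-right eq))

  pullback-unglue : ∀ {P Q A B C D} {p₁ : P ⇒ A} {p₂ : P ⇒ B} {f : A ⇒ C} {g : B ⇒ C}
                      {q₁ : Q ⇒ D} {r : Q ⇒ B} {h : D ⇒ A} →
                    IsPullback p₁ p₂ f g → IsPullback q₁ r (f ∘ h) g →
                    (q₂ : Q ⇒ P) → p₁ ∘ q₂ ≈ h ∘ q₁ → p₂ ∘ q₂ ≈ r →
                    IsPullback q₁ q₂ h p₁
  pullback-unglue {P = P} {D = D} {p₁ = p₁} {p₂} {f} {g} {q₁} {r} {h} right outer q₂ p₁q₂≈hq₁ p₂q₂≈r = record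
    { commute      = sym p₁q₂≈hq₁
    ; universal    = λ eq → universal outer (to-outer eq)
    ; universal-p₁ = λ eq → universal-p₁ outer (to-outer eq)
    ; universal-p₂ = λ eq → pullback-ext right
        (trans (pullˡ p₁q₂≈hq₁) (trans (pullʳ (universal-p₁ outer (to-outer eq))) eq))
        (trans (pullˡ p₂q₂≈r) (universal-p₂ outer (to-outer eq)))
    ; unique       = λ eq u q₁u≈x₁ q₂u≈x₂ → unique outer (to-outer eq) u q₁u≈x₁
        (trans (sym p₂q₂≈r ⟩∘⟨refl) (pullʳ q₂u≈x₂))
    }
    where
      open IsPullback
      to-outer : ∀ {X} {x₁ : X ⇒ D} {x₂ : X ⇒ P} → h ∘ x₁ ≈ p₁ ∘ x₂ →
                 (f ∘ h) ∘ x₁ ≈ g ∘ (p₂ ∘ x₂)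
      to-outer {x₁ = x₁} {x₂} eq = begin
        (f ∘ h) ∘ x₁ ≈⟨ pullʳ eq ⟩
        f ∘ (p₁ ∘ x₂) ≈⟨ pullˡ (commute right) ⟩
        (g ∘ p₂) ∘ x₂ ≈⟨ assoc ⟩
        g ∘ (p₂ ∘ x₂) ∎

module CoveringSquareProperties {o ℓ e} {𝒞 : Category o ℓ e} (H : PositiveHeyting 𝒞) where
  open Category 𝒞
  open Notions 𝒞
  open CategoryProperties 𝒞
  open PositiveHeyting H using (pb; cover-stable)
  open HeytingNotions H using (CoveringSquare; CoveredBy; IsRepresentation)
  open IsPullback

  cover-∘ : ∀ {A B C} {c : A ⇒ B} {g : B ⇒ C} → Cover c → Cover g → Cover (g ∘ c)
  cover-∘ {c = c} {g} c-cover g-cover k m gc≈mk m-mono = g-cover (q₁ ∘ r) m g≈m∘q₁r m-mono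
    where
      open Pullback (pb m g) renaming (p₁ to q₁; p₂ to q₂; isPullback to m×g)
      c-through-q₂ = universal m×g (sym gc≈mk)
      q₂-iso = c-cover c-through-q₂ q₂ (sym (universal-p₂ m×g (sym gc≈mk)))
                       (pullback-of-mono m×g m-mono)
      r = proj₁ q₂-iso
      g≈m∘q₁r : g ≈ m ∘ (q₁ ∘ r)
      g≈m∘q₁r = begin
        g ≈⟨ sym identityʳ ⟩
        g ∘ id ≈⟨ refl⟩∘⟨ sym (proj₂ (proj₂ q₂-iso)) ⟩
        g ∘ (q₂ ∘ r) ≈⟨ pullˡ (sym (commute m×g)) ⟩
        (m ∘ q₁) ∘ r ≈⟨ assoc ⟩
        m ∘ (q₁ ∘ r) ∎

  cover-into-pullback-transfer :
    ∀ {D P P' A B C} {a₁ : P ⇒ A} {a₂ : P ⇒ B} {a₁' : P' ⇒ A} {a₂' : P' ⇒ B}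
      {f : A ⇒ C} {g : B ⇒ C} {x : D ⇒ A} {y : D ⇒ B} →
    IsPullback a₁ a₂ f g → IsPullback a₁' a₂' f g →
    (u : D ⇒ P) (u' : D ⇒ P') → a₁ ∘ u ≈ x → a₂ ∘ u ≈ y → a₁' ∘ u' ≈ x → a₂' ∘ u' ≈ y →
    Cover u → Cover u'
  cover-into-pullback-transfer pullback pullback' u u' a₁u≈x a₂u≈y a₁'u'≈x a₂'u'≈y u-cover
    with pullback-comparison pullback pullback'
  ... | φ , φ-iso , a₁'φ≈a₁ , a₂'φ≈a₂ =
    cover-resp-≈ (pullback-ext pullback' (trans (pullˡ a₁'φ≈a₁) (trans a₁u≈x (sym a₁'u'≈x)))
                                         (trans (pullˡ a₂'φ≈a₂) (trans a₂u≈y (sym a₂'u'≈y))))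
                 (cover-∘ u-cover (iso⇒cover φ-iso))

  module _ {D X B A} {left : D ⇒ B} {top : D ⇒ X} {right : X ⇒ A} {bottom : B ⇒ A} where

    mkCoveringSquare : ∀ {P} {a₁ : P ⇒ B} {a₂ : P ⇒ X} →
                       bottom ∘ left ≈ right ∘ top → Cover bottom →
                       IsPullback a₁ a₂ bottom right → (u : D ⇒ P) →
                       a₁ ∘ u ≈ left → a₂ ∘ u ≈ top → Cover u →
                       CoveringSquare left top right bottom
    mkCoveringSquare commutes bottom-cover pullback u a₁u≈left a₂u≈top u-cover = record
      { commutes     = commutes
      ; bottom-cover = bottom-cover
      ; corner-cover = cover-into-pullback-transfer pullback canonical u (universal canonical commutes)
          a₁u≈left a₂u≈top (universal-p₁ canonical commutes) (universal-p₂ canonical commutes) u-cover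
      }
      where canonical = Pullback.isPullback (pb bottom right)

    CoveringSquare-corner : CoveringSquare left top right bottom →
                            ∀ {P} {a₁ : P ⇒ B} {a₂ : P ⇒ X} →
                            IsPullback a₁ a₂ bottom right → (u : D ⇒ P) →
                            a₁ ∘ u ≈ left → a₂ ∘ u ≈ top → Cover u
    CoveringSquare-corner square pullback u a₁u≈left a₂u≈top =
      cover-into-pullback-transfer canonical pullback (universal canonical commutes) u
        (universal-p₁ canonical commutes) (universal-p₂ canonical commutes) a₁u≈left a₂u≈top
        corner-cover
      where
        open CoveringSquare square
        canonical = Pullback.isPullback (pb bottom right)

  CoveringSquare-resp-≈ : ∀ {D X B A} {left : D ⇒ B} {top top' : D ⇒ X} {right : X ⇒ A}
                            {bottom bottom' : B ⇒ A} →
                          CoveringSquare left top right bottom → top ≈ top' → bottom ≈ bottom' →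
                          CoveringSquare left top' right bottom'
  CoveringSquare-resp-≈ {right = right} {bottom} square top≈top' bottom≈bottom' =
    mkCoveringSquare (trans (sym bottom≈bottom' ⟩∘⟨refl) (trans commutes (refl⟩∘⟨ top≈top')))
      (cover-resp-≈ bottom≈bottom' bottom-cover) (pullback-resp-≈ canonical bottom≈bottom' ≈-refl)
      (universal canonical commutes) (universal-p₁ canonical commutes)
      (trans (universal-p₂ canonical commutes) top≈top') corner-cover
    where
      open CoveringSquare square
      canonical = Pullback.isPullback (pb bottom right)

  pullback-along-cover : ∀ {P A B C} {p₁ : P ⇒ A} {p₂ : P ⇒ B} {f : A ⇒ C} {c : B ⇒ C} →
                         IsPullback p₁ p₂ f c → Cover c → CoveringSquare p₂ p₁ f c
  pullback-along-cover pullback c-cover =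
    mkCoveringSquare (sym (commute pullback)) c-cover (pullback-swap pullback)
      id identityʳ identityʳ (iso⇒cover id-iso)

  CoveredBy-refl : ∀ {X A} (f : X ⇒ A) → CoveredBy f f
  CoveredBy-refl f = id , id , pullback-along-cover (pullback-along-id f) (iso⇒cover id-iso)

  CoveringSquare-∘ : ∀ {D X B A D' B'} {g : D ⇒ B} {t : D ⇒ X} {f : X ⇒ A} {b : B ⇒ A}
                       {k : D' ⇒ B'} {t' : D' ⇒ D} {b' : B' ⇒ B} →
                     CoveringSquare g t f b → CoveringSquare k t' g b' →
                     CoveringSquare k (t ∘ t') f (b ∘ b')
  CoveringSquare-∘ {g = g} {t} {f} {b} {k} {t'} {b'} upper lower =
    mkCoveringSquare outer-commutes (cover-∘ (bottom-cover lower) (bottom-cover upper))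
      (pullback-glue b×f b'×s₁) (q₁ ∘ u) r₁q₁u≈k s₂r₂q₁u≈tt' (cover-∘ u-cover q₁-cover)
    where
      open CoveringSquare using (bottom-cover; corner-cover)
      outer-commutes : (b ∘ b') ∘ k ≈ f ∘ (t ∘ t')
      outer-commutes = begin
        (b ∘ b') ∘ k ≈⟨ pullʳ (CoveringSquare.commutes lower) ⟩
        b ∘ (g ∘ t') ≈⟨ pullˡ (CoveringSquare.commutes upper) ⟩
        (f ∘ t) ∘ t' ≈⟨ assoc ⟩
        f ∘ (t ∘ t') ∎
      open Pullback (pb b f) renaming (p₁ to s₁; p₂ to s₂; isPullback to b×f)
      c = universal b×f (CoveringSquare.commutes upper)
      s₁c≈g = universal-p₁ b×f (CoveringSquare.commutes upper)
      s₂c≈t = universal-p₂ b×f (CoveringSquare.commutes upper)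
      open Pullback (pb b' s₁) renaming (p₁ to r₁; p₂ to r₂; isPullback to b'×s₁)
      open Pullback (pb r₂ c) renaming (p₁ to q₁; p₂ to q₂; isPullback to r₂×c)
      q₁-cover : Cover q₁
      q₁-cover = cover-stable (pullback-swap r₂×c) (corner-cover upper)
      b'×g : IsPullback (r₁ ∘ q₁) q₂ b' g
      b'×g = pullback-swap (pullback-resp-≈
               (pullback-glue (pullback-swap b'×s₁) (pullback-swap r₂×c)) s₁c≈g ≈-refl)
      u = universal b'×g (CoveringSquare.commutes lower)
      u-cover : Cover u
      u-cover = CoveringSquare-corner lower b'×g u
        (universal-p₁ b'×g (CoveringSquare.commutes lower))
        (universal-p₂ b'×g (CoveringSquare.commutes lower))
      r₁q₁u≈k : r₁ ∘ (q₁ ∘ u) ≈ k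
      r₁q₁u≈k = trans (sym assoc) (universal-p₁ b'×g (CoveringSquare.commutes lower))
      s₂r₂q₁u≈tt' : (s₂ ∘ r₂) ∘ (q₁ ∘ u) ≈ t ∘ t'
      s₂r₂q₁u≈tt' = begin
        (s₂ ∘ r₂) ∘ (q₁ ∘ u) ≈⟨ pullʳ (pullˡ (commute r₂×c)) ⟩
        s₂ ∘ ((c ∘ q₂) ∘ u) ≈⟨ refl⟩∘⟨ assoc ⟩
        s₂ ∘ (c ∘ (q₂ ∘ u)) ≈⟨ pullˡ s₂c≈t ⟩
        t ∘ (q₂ ∘ u) ≈⟨ refl⟩∘⟨ universal-p₂ b'×g (CoveringSquare.commutes lower) ⟩
        t ∘ t' ∎

  CoveredBy-trans : ∀ {X A D B D' B'} {f : X ⇒ A} {g : D ⇒ B} {k : D' ⇒ B'} →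
                    CoveredBy f g → CoveredBy g k → CoveredBy f k
  CoveredBy-trans (t , b , upper) (t' , b' , lower) = t ∘ t' , b ∘ b' , CoveringSquare-∘ upper lower

  -- Pulling the covering square (g, t, f, b) back along h: the corner of the new
  -- square is a pullback of the old corner, hence a cover.
  CoveredBy-pullback : ∀ {D B X A P A'} {f : X ⇒ A} {g : D ⇒ B}
                         {p₁ : P ⇒ X} {p₂ : P ⇒ A'} {h : A' ⇒ A} →
                       CoveredBy f g → IsPullback p₁ p₂ f h →
                       Σ[ W ∈ Obj ] Σ[ Q ∈ Obj ] Σ[ w ∈ W ⇒ B ] Σ[ e₁ ∈ Q ⇒ D ] Σ[ e₂ ∈ Q ⇒ W ]
                         (IsPullback e₁ e₂ g w × CoveredBy p₂ e₂)
  CoveredBy-pullback {f = f} {g} {p₁ = p₁} {p₂} {h} (t , b , square) f×h =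
    W , Q , w₁ , k₁ , n₁ ∘ k₂ , g×w₁ , n₂ ∘ k₂ , w₂ , new-square
    where
      open CoveringSquare square
      open Pullback (pb b f) renaming (p₁ to m₁; p₂ to m₂; isPullback to b×f)
      c = universal b×f commutes
      open Pullback (pb b h) renaming (P to W; p₁ to w₁; p₂ to w₂; isPullback to b×h)
      open Pullback (pb w₂ p₂) renaming (p₁ to n₁; p₂ to n₂; isPullback to w₂×p₂)
      bw₁×f : IsPullback n₁ (p₁ ∘ n₂) (b ∘ w₁) f
      bw₁×f = pullback-resp-≈ (pullback-glue (pullback-swap f×h) w₂×p₂)
                (sym (commute b×h)) ≈-refl
      ν-commutes : b ∘ (w₁ ∘ n₁) ≈ f ∘ (p₁ ∘ n₂)
      ν-commutes = trans (sym assoc) (commute bw₁×f)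
      ν = universal b×f ν-commutes
      w₁×m₁ : IsPullback n₁ ν w₁ m₁
      w₁×m₁ = pullback-unglue b×f bw₁×f ν (universal-p₁ b×f ν-commutes)
                (universal-p₂ b×f ν-commutes)
      open Pullback (pb c ν) renaming (P to Q; p₁ to k₁; p₂ to k₂; isPullback to c×ν)
      g×w₁ : IsPullback k₁ (n₁ ∘ k₂) g w₁
      g×w₁ = pullback-resp-≈ (pullback-glue (pullback-swap w₁×m₁) c×ν)
               (universal-p₁ b×f commutes) ≈-refl
      new-square : CoveringSquare (n₁ ∘ k₂) (n₂ ∘ k₂) p₂ w₂
      new-square = mkCoveringSquare (trans (pullˡ (commute w₂×p₂)) assoc)
        (cover-stable b×h bottom-cover) w₂×p₂ k₂ ≈-refl ≈-refl (cover-stable c×ν corner-cover)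

  -- The pullback of π along h ∘ c is the pullback of p₂ along the cover c.
  CoveredBy-pullback-along-cover :
    ∀ {E U V V' P P'} {π : E ⇒ U} {h : V ⇒ U} {c : V' ⇒ V}
      {p₁ : P ⇒ E} {p₂ : P ⇒ V} {a₁ : P' ⇒ E} {a₂ : P' ⇒ V'} →
    IsPullback p₁ p₂ π h → Cover c → IsPullback a₁ a₂ π (h ∘ c) → CoveredBy p₂ a₂
  CoveredBy-pullback-along-cover {π = π} {h} {c} {p₁} {p₂} {a₁} {a₂} π×h c-cover π×hc =
    k , c , pullback-along-cover (pullback-swap c×p₂) c-cover
    where
      k-commutes : π ∘ a₁ ≈ h ∘ (c ∘ a₂)
      k-commutes = trans (commute π×hc) assoc
      k = universal π×h k-commutes
      c×p₂ : IsPullback a₂ k c p₂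
      c×p₂ = pullback-unglue (pullback-swap π×h) (pullback-swap π×hc) k
               (universal-p₂ π×h k-commutes) (universal-p₁ π×h k-commutes)

  representation-coveredBy : ∀ {t} (T : Class 𝒞 t) {E U D B} {ρ : E ⇒ U} {σ : D ⇒ B} →
                             IsRepresentation T ρ → T σ → CoveredBy ρ σ → IsRepresentation T σ
  representation-coveredBy T (_ , represent) Tσ ρ◁σ = Tσ , λ f Tf →
    let (_ , _ , _ , _ , _ , π×h , f◁p₂) = represent f Tf
        (W , Q , w , e₁ , e₂ , σ×w , p₂◁e₂) = CoveredBy-pullback ρ◁σ π×h
    in W , Q , w , e₁ , e₂ , σ×w , CoveredBy-trans f◁p₂ p₂◁e₂

module ExactCompletionProperties {o ℓ e s o' ℓ' e' s'}
  {𝓔 : Category o ℓ e} (H𝓔 : PositiveHeyting 𝓔) (S : Class 𝓔 s)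
  {𝓔̄ : Category o' ℓ' e'} (H𝓔̄ : PositiveHeyting 𝓔̄) (S̄ : Class 𝓔̄ s')
  (y : Morphism H𝓔 (HeytingNotions.Cov H𝓔 S) H𝓔̄ S̄)
  (completion : CompletionProperties H𝓔 S H𝓔̄ S̄ y) where
  private
    module E = Category 𝓔
    module Ē = Category 𝓔̄
    module NE = Notions 𝓔
    module NĒ = Notions 𝓔̄
    module HE = HeytingNotions H𝓔
    module HĒ = HeytingNotions H𝓔̄
    module PE = CategoryProperties 𝓔
    module PĒ = CategoryProperties 𝓔̄
    module CE = CoveringSquareProperties H𝓔
    module CĒ = CoveringSquareProperties H𝓔̄
  open PĒ using (sym; trans; _⟩∘⟨refl; refl⟩∘⟨_)
  open Morphism y
  open CompletionProperties completion

  y-mono : ∀ {A B} {m : A E.⇒ B} → NE.Mono m → NĒ.Mono (F₁ m)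
  y-mono m-mono = PĒ.equal-kernel-pair⇒mono (pres-pullback (PE.mono⇒trivial-kernel-pair m-mono))

  y-reflects-cover : ∀ {A B} {f : A E.⇒ B} → NĒ.Cover (F₁ f) → NE.Cover f
  y-reflects-cover yf-cover g m f≈mg m-mono
    with yf-cover (F₁ g) (F₁ m) (trans (F-resp-≈ f≈mg) homomorphism) (y-mono m-mono)
  ... | ȳm⁻¹ , ȳm⁻¹∘ym≈id , ym∘ȳm⁻¹≈id with full ȳm⁻¹
  ... | m⁻¹ , ym⁻¹≈ȳm⁻¹ =
    m⁻¹ , faithful (trans homomorphism (trans (ym⁻¹≈ȳm⁻¹ ⟩∘⟨refl) (trans ȳm⁻¹∘ym≈id (sym identity))))
        , faithful (trans homomorphism (trans (refl⟩∘⟨ ym⁻¹≈ȳm⁻¹) (trans ym∘ȳm⁻¹≈id (sym identity))))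

  module _ {D X B A} {g : D E.⇒ B} {t : D E.⇒ X} {f : X E.⇒ A} {b : B E.⇒ A} where
    private
      open NE.Pullback (PositiveHeyting.pb H𝓔 b f) renaming (p₁ to m₁; p₂ to m₂; isPullback to b×f)

      y-corner : (commutes : b E.∘ g E.≈ f E.∘ t) →
                 F₁ m₁ Ē.∘ F₁ (NE.IsPullback.universal b×f commutes) Ē.≈ F₁ g
                 × F₁ m₂ Ē.∘ F₁ (NE.IsPullback.universal b×f commutes) Ē.≈ F₁ t
      y-corner commutes =
          trans (sym homomorphism) (F-resp-≈ (NE.IsPullback.universal-p₁ b×f commutes))
        , trans (sym homomorphism) (F-resp-≈ (NE.IsPullback.universal-p₂ b×f commutes))

    y-CoveringSquare : HE.CoveringSquare g t f b → HĒ.CoveringSquare (F₁ g) (F₁ t) (F₁ f) (F₁ b)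
    y-CoveringSquare square =
      CĒ.mkCoveringSquare (trans (sym homomorphism) (trans (F-resp-≈ commutes) homomorphism))
        (pres-cover bottom-cover) (pres-pullback b×f) (F₁ (NE.IsPullback.universal b×f commutes))
        (proj₁ (y-corner commutes)) (proj₂ (y-corner commutes)) (pres-cover corner-cover)
      where open HE.CoveringSquare square

    y-reflects-CoveringSquare : HĒ.CoveringSquare (F₁ g) (F₁ t) (F₁ f) (F₁ b) →
                                HE.CoveringSquare g t f b
    y-reflects-CoveringSquare square = record
      { commutes     = commutes
      ; bottom-cover = y-reflects-cover (HĒ.CoveringSquare.bottom-cover square)
      ; corner-cover = y-reflects-cover (CĒ.CoveringSquare-corner square (pres-pullback b×f)
          (F₁ (NE.IsPullback.universal b×f commutes))
          (proj₁ (y-corner commutes)) (proj₂ (y-corner commutes)))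
      }
      where
        commutes : b E.∘ g E.≈ f E.∘ t
        commutes = faithful (trans homomorphism
                     (trans (HĒ.CoveringSquare.commutes square) (sym homomorphism)))

  y-CoveredBy : ∀ {X A D B} {f : X E.⇒ A} {g : D E.⇒ B} →
                HE.CoveredBy f g → HĒ.CoveredBy (F₁ f) (F₁ g)
  y-CoveredBy (t , b , square) = F₁ t , F₁ b , y-CoveringSquare square

  y-reflects-CoveredBy : ∀ {X A D B} {f : X E.⇒ A} {g : D E.⇒ B} →
                         HĒ.CoveredBy (F₁ f) (F₁ g) → HE.CoveredBy f g
  y-reflects-CoveredBy (t̄ , b̄ , square) =
    let (t , yt≈t̄) = full t̄
        (b , yb≈b̄) = full b̄
    in t , b , y-reflects-CoveringSquare (CĒ.CoveringSquare-resp-≈ square (sym yt≈t̄) (sym yb≈b̄))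

  y-small : ∀ {A B} {f : A E.⇒ B} → S f → S̄ (F₁ f)
  y-small {f = f} Sf = pres-small (_ , _ , f , Sf , CE.CoveredBy-refl f)

  y-IsRepresentation : ∀ {E U} (π : E E.⇒ U) → S π →
                       HE.IsRepresentation S π → HĒ.IsRepresentation S̄ (F₁ π)
  y-IsRepresentation π Sπ (_ , represent) = y-small Sπ , λ f S̄f →
    let (_ , _ , f' , Sf' , f◁yf') = Equivalence.to (small-maps f) S̄f
        (V , P , h , p₁ , p₂ , π×h , f'◁p₂) = represent f' Sf'
    in F₀ V , F₀ P , F₁ h , F₁ p₁ , F₁ p₂ , pres-pullback π×h
       , CĒ.CoveredBy-trans f◁yf' (y-CoveredBy f'◁p₂)

  y-reflects-IsRepresentation : ∀ {E U} (π : E E.⇒ U) → S π →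
                                HĒ.IsRepresentation S̄ (F₁ π) → HE.IsRepresentation S π
  y-reflects-IsRepresentation π Sπ (_ , represent) = Sπ , λ f Sf →
    let (V̄ , _ , h , _ , _ , yπ×h , yf◁p₂) = represent (F₁ f) (y-small Sf)
        (A' , c , c-cover) = covering V̄
        (h' , yh'≈hc) = full (h Ē.∘ c)
        open NE.Pullback (PositiveHeyting.pb H𝓔 π h') renaming (isPullback to π×h')
        yπ×hc = PĒ.pullback-resp-≈ (pres-pullback π×h') Ē.≈-refl yh'≈hc
        p₂◁ya₂ = CĒ.CoveredBy-pullback-along-cover yπ×h c-cover yπ×hc
    in A' , P , h' , p₁ , p₂ , π×h' , y-reflects-CoveredBy (CĒ.CoveredBy-trans yf◁p₂ p₂◁ya₂)

  y-Representable : HE.Representable S → HĒ.Representable S̄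
  y-Representable (E , U , π , representation) =
    F₀ E , F₀ U , F₁ π , y-IsRepresentation π (proj₁ representation) representation

  Representable-from-completion : HĒ.Representable S̄ → HE.Representable S
  Representable-from-completion (_ , _ , ρ , representation) =
    let (D , B , f' , Sf' , ρ◁yf') = Equivalence.to (small-maps ρ) (proj₁ representation)
    in D , B , f' , y-reflects-IsRepresentation f' Sf'
         (CĒ.representation-coveredBy S̄ representation (y-small Sf') ρ◁yf')

proposition6p2 : ∀ {o ℓ e s o' ℓ' e' s' : Level}
    {𝓔 : Category o ℓ e} (H𝓔 : PositiveHeyting 𝓔) (S : Class 𝓔 s) →
    HeytingNotions.IsClassOfDisplayMaps H𝓔 S →
    {𝓔̄ : Category o' ℓ' e'} (H𝓔̄ : PositiveHeyting 𝓔̄) (S̄ : Class 𝓔̄ s') →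
    (y : Morphism H𝓔 (HeytingNotions.Cov H𝓔 S) H𝓔̄ S̄) →
    IsExactCompletion H𝓔 S H𝓔̄ S̄ y →
    CompletionProperties H𝓔 S H𝓔̄ S̄ y →
    (HeytingNotions.Representable H𝓔 S ⇔ HeytingNotions.Representable H𝓔̄ S̄)
    × (∀ {E U : Category.Obj 𝓔} (π : Category._⇒_ 𝓔 E U) → S π →
    HeytingNotions.IsRepresentation H𝓔 S π
    ⇔ HeytingNotions.IsRepresentation H𝓔̄ S̄ (Morphism.F₁ y π))
proposition6p2 H𝓔 S _ H𝓔̄ S̄ y _ completion =
    mk⇔ y-Representable Representable-from-completion
  , λ π Sπ → mk⇔ (y-IsRepresentation π Sπ) (y-reflects-IsRepresentation π Sπ)
  where open ExactCompletionProperties H𝓔 S H𝓔̄ S̄ y completion
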